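{- For integers $m_0,m_1,m_2,m_3\ge 2$, the twisted graph $G(m_0,m_1,m_2,m_3)$ is $3$-existentially complete triangle-free.
   Context: $G(m_0,m_1,m_2,m_3)$ has vertex set $\{(i,j,x): i\in\{0,1,2,3\},\ 1\le j\le m_i,\ x\in\mathbb{Z}_4\}$, and its edges are exactly: $(i,j,x)\sim(i,j,x+1)$ for all $i,j,x$; $(i,j,x)\sim(i,j',x+2)$ for all $i,x$ and $j\ne j'$; $(i,j,x)\sim(i',j',x+3)$ for all $x,j,j'$ and $(i,i')\in\{(0,1),(0,2),(0,3),(1,2),(2,3),(3,1)\}$ (addition in $\mathbb{Z}_4$; adjacency is symmetric). A graph $G=(V,E)$ is \emph{$3$-existentially complete triangle-free} if it is triangle-free and for every $B\subseteq A\subseteq V$ with $|A|\le 3$ and $B$ independent, there exists a vertex $v\in V\setminus A$ adjacent to every vertex of $B$ and to no vertex of $A\setminus B$. -}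

module Defs where

open import Data.Nat using (ℕ; _≤_; _%_)
open import Data.Fin using (Fin; zero; suc; toℕ; fromℕ<)
open import Data.Nat.DivMod using (m%n<n)
open import Data.Product using (Σ; _×_; _,_; ∃-syntax)
open import Data.Sum using (_⊎_)
open import Data.List using (List; length)
open import Data.List.Membership.Propositional using (_∈_; _∉_)
open import Relation.Nullary using (¬_)
open import Relation.Binary.PropositionalEquality using (_≡_)

record Graph : Set₁ where
  field
    V   : Set
    Adj : V → V → Set

module _ (G : Graph) where
  open Graph G

  TriangleFree : Set
  TriangleFree = ∀ x y z → ¬ (Adj x y × Adj y z × Adj x z)

  Independent : List V → Set
  Independent B = ∀ x y → x ∈ B → y ∈ B → ¬ Adj x y

  ExtensionProperty3 : Set
  ExtensionProperty3 =
    ∀ (A B : List V) → length A ≤ 3 → (∀ b → b ∈ B → b ∈ A) → Independent B →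
    ∃[ v ] (v ∉ A × (∀ b → b ∈ B → Adj v b)
                  × (∀ a → a ∈ A → a ∉ B → ¬ Adj v a))

  ThreeECTriangleFree : Set
  ThreeECTriangleFree = TriangleFree × ExtensionProperty3

_+₄_ : Fin 4 → ℕ → Fin 4
x +₄ k = fromℕ< (m%n<n (toℕ x Data.Nat.+ k) 4)

-- The twisted graph G(m₀,m₁,m₂,m₃).  Index j ranges over Fin (m i)
-- (0-based instead of 1..m_i).

TVertex : (Fin 4 → ℕ) → Set
TVertex m = Σ (Fin 4) λ i → Fin (m i) × Fin 4

data Arc : Fin 4 → Fin 4 → Set where
  a01 : Arc zero (suc zero)
  a02 : Arc zero (suc (suc zero))
  a03 : Arc zero (suc (suc (suc zero)))
  a12 : Arc (suc zero) (suc (suc zero))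
  a23 : Arc (suc (suc zero)) (suc (suc (suc zero)))
  a31 : Arc (suc (suc (suc zero))) (suc zero)

data TEdge (m : Fin 4 → ℕ) : TVertex m → TVertex m → Set where
  e1 : ∀ i j x → TEdge m (i , j , x) (i , j , x +₄ 1)
  e2 : ∀ i j j' x → ¬ j ≡ j' → TEdge m (i , j , x) (i , j' , x +₄ 2)
  e3 : ∀ i i' j j' x → Arc i i' → TEdge m (i , j , x) (i' , j' , x +₄ 3)

TAdj : (m : Fin 4 → ℕ) → TVertex m → TVertex m → Set
TAdj m u v = TEdge m u v ⊎ TEdge m v u

Twisted : (Fin 4 → ℕ) → Graph
Twisted m = record { V = TVertex m ; Adj = TAdj m }

-- Whether two vertices of G(m₀,m₁,m₂,m₃) are adjacent depends only on their
-- parts, on whether they share a column, and on the difference of their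
-- positions in ℤ₄.  So all that matters about three vertices is their shape:
-- their parts, their positions relative to the first one, and which of them
-- share a column.  A candidate for the extension property is described the
-- same way, by its position and by lying in the column of one of the three or
-- in a fresh column; the latter exists in part q as soon as the three meet q
-- in at most one column, since every part has at least two columns.  For the
-- finitely many shapes both triangle-freeness and the existence of a suitable
-- candidate are checked by evaluation.
module Submission where

open import Defs
open import Data.Bool using (Bool; true; false; T; not; _∧_; _∨_)
open import Data.Bool.ListAction using (all; any)
open import Data.Bool.Properties using (T-≡; T-not-≡; T-∧; T-∨; ⇔→≡) renaming (_≟_ to _≟ᵇ_)
open import Data.Empty using (⊥; ⊥-elim)
open import Data.Fin as Fin using (Fin; toℕ)
open import Data.Fin.Patterns using (0F; 1F; 2F; 3F)
open import Data.Fin.Properties using (_≟_)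
open import Data.List as List using (List; []; _∷_; length; allFin; cartesianProduct; _++_)
open import Data.List.Membership.Propositional using (_∈_; _∉_)
open import Data.List.Relation.Unary.Enumerates.Setoid using (IsEnumeration)
import Data.List.Membership.DecPropositional as DecMembership
open import Data.List.Membership.Propositional.Properties using (∈-allFin; ∈-map⁺; ∈-cartesianProduct⁺)
open import Data.List.Relation.Unary.All using (lookup)
open import Data.List.Relation.Unary.All.Properties using (all⁺)
open import Data.List.Relation.Unary.Any using (here; there; satisfied)
open import Data.List.Relation.Unary.Any.Properties using (any⁻)
open import Data.Nat using (ℕ; zero; suc; _∸_; _≤_; s≤s)
open import Data.Product using (Σ; ∃; _×_; _,_; proj₁; proj₂; uncurry)
open import Data.Product.Properties using (≡-dec)
open import Data.Sum as Sum using (_⊎_; inj₁; inj₂)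
open import Data.Unit using (tt)
open import Data.Vec as Vec using (Vec; []; _∷_; replicate)
open import Data.Vec.Properties using (lookup-map)
open import Function using (_∘_; _$_; _⇔_; mk⇔; Equivalence)
open import Relation.Binary.Definitions using (DecidableEquality)
open import Relation.Binary.PropositionalEquality using (_≡_; _≢_; refl; sym; trans; cong; subst; setoid)
open import Relation.Nullary using (¬_; Dec; yes; no)
open import Relation.Nullary.Decidable
  using (⌊_⌋; _→-dec_; toWitness; fromWitness; fromWitnessFalse)

open Equivalence using (to; from)

private
  variable
    A : Set
    n : ℕ

bools : List Bool
bools = true ∷ false ∷ []

bools-enumerates : IsEnumeration (setoid Bool) bools
bools-enumerates true = here refl
bools-enumerates false = there (here refl)

vecs : List A → ∀ n → List (Vec A n)
vecs xs zero = [] ∷ []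
vecs xs (suc n) = List.map (uncurry _∷_) (cartesianProduct xs (vecs xs n))

vecs-enumerates : ∀ {xs : List A} → IsEnumeration (setoid A) xs →
                  ∀ n → IsEnumeration (setoid (Vec A n)) (vecs xs n)
vecs-enumerates xs-enumerates zero [] = here refl
vecs-enumerates xs-enumerates (suc n) (x ∷ v) =
  ∈-map⁺ (uncurry _∷_) (∈-cartesianProduct⁺ (xs-enumerates x) (vecs-enumerates xs-enumerates n v))

all-elements : ∀ {xs : List A} → IsEnumeration (setoid A) xs →
               (p : A → Bool) → all p xs ≡ true → ∀ a → T (p a)
all-elements {xs = xs} xs-enumerates p holds a = lookup (all⁺ p xs (from T-≡ holds)) (xs-enumerates a)

decide : ∀ {xs : List A} → IsEnumeration (setoid A) xs → {P : A → Set} (P? : ∀ a → Dec (P a)) →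
         all (⌊_⌋ ∘ P?) xs ≡ true → ∀ a → P a
decide xs-enumerates P? holds a = toWitness (all-elements xs-enumerates (⌊_⌋ ∘ P?) holds a)

any-element : (xs : List A) (p : A → Bool) → T (any p xs) → ∃ (T ∘ p)
any-element xs p holds = satisfied (any⁻ p xs holds)

_⇒_ : Bool → Bool → Bool
a ⇒ b = not a ∨ b

⇒-elim : ∀ {a b} → T (a ⇒ b) → T a → T b
⇒-elim {true} h _ = h

⇒-intro : ∀ {a b} → (T a → T b) → T (a ⇒ b)
⇒-intro {true} f = f tt
⇒-intro {false} _ = tt

not-elim : ∀ {a} → T (not a) → ¬ T a
not-elim {false} _ ()

not-intro : ∀ {a} → ¬ T a → T (not a)
not-intro {true} ¬a = ¬a tt
not-intro {false} _ = tt

all₃ : (Fin 3 → Bool) → Bool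
all₃ f = f 0F ∧ f 1F ∧ f 2F

all₃-elim : ∀ f → T (all₃ f) → ∀ k → T (f k)
all₃-elim f h 0F = proj₁ (to (T-∧ {f 0F}) h)
all₃-elim f h 1F = proj₁ (to (T-∧ {f 1F}) (proj₂ (to (T-∧ {f 0F}) h)))
all₃-elim f h 2F = proj₂ (to (T-∧ {f 1F}) (proj₂ (to (T-∧ {f 0F}) h)))

allPairs₃ : (Fin 3 → Fin 3 → Bool) → Bool
allPairs₃ f = f 0F 1F ∧ f 0F 2F ∧ f 1F 2F

allPairs₃-intro : ∀ {f} → (∀ k l → T (f k l)) → T (allPairs₃ f)
allPairs₃-intro h = from T-∧ (h 0F 1F , from T-∧ (h 0F 2F , h 1F 2F))

allPairs₃-elim : ∀ f → T (allPairs₃ f) → T (f 0F 1F) × T (f 0F 2F) × T (f 1F 2F)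
allPairs₃-elim f h =
  let h₀₁ , h′ = to (T-∧ {f 0F 1F}) h in h₀₁ , to (T-∧ {f 0F 2F}) h′

_⊖_ : Fin 4 → Fin 4 → Fin 4
y ⊖ x = y +₄ (4 ∸ toℕ x)

ℤ₄²-enumerates : IsEnumeration (setoid (Fin 4 × Fin 4)) (cartesianProduct (allFin 4) (allFin 4))
ℤ₄²-enumerates (x , y) = ∈-cartesianProduct⁺ (∈-allFin x) (∈-allFin y)

ℤ₄³-enumerates : IsEnumeration (setoid (Fin 4 × Fin 4 × Fin 4))
                              (cartesianProduct (allFin 4) (cartesianProduct (allFin 4) (allFin 4)))
ℤ₄³-enumerates (c , x , y) = ∈-cartesianProduct⁺ (∈-allFin c) (ℤ₄²-enumerates (x , y))

+₄-⊖ : ∀ x y → x +₄ toℕ (y ⊖ x) ≡ y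
+₄-⊖ x y = decide ℤ₄²-enumerates (λ (x , y) → x +₄ toℕ (y ⊖ x) ≟ y) refl (x , y)

⊖-+₄ : ∀ x d → (x +₄ toℕ d) ⊖ x ≡ d
⊖-+₄ x d = decide ℤ₄²-enumerates (λ (x , d) → (x +₄ toℕ d) ⊖ x ≟ d) refl (x , d)

⊖-self : ∀ x → x ⊖ x ≡ 0F
⊖-self = decide ∈-allFin (λ x → x ⊖ x ≟ 0F) refl

⊖-⊖-cancel : ∀ c x y → (y ⊖ c) ⊖ (x ⊖ c) ≡ y ⊖ x
⊖-⊖-cancel c x y =
  decide ℤ₄³-enumerates (λ (c , x , y) → (y ⊖ c) ⊖ (x ⊖ c) ≟ y ⊖ x) refl (c , x , y)

⊖-injective : ∀ c x y → x ⊖ c ≡ y ⊖ c → x ≡ y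
⊖-injective c x y =
  decide ℤ₄³-enumerates (λ (c , x , y) → x ⊖ c ≟ y ⊖ c →-dec x ≟ y) refl (c , x , y)

-- Adjacency as a function of shape

arc? : ∀ p q → Dec (Arc p q)
arc? 0F 0F = no λ ()
arc? 0F 1F = yes a01
arc? 0F 2F = yes a02
arc? 0F 3F = yes a03
arc? 1F 0F = no λ ()
arc? 1F 1F = no λ ()
arc? 1F 2F = yes a12
arc? 1F 3F = no λ ()
arc? 2F 0F = no λ ()
arc? 2F 1F = no λ ()
arc? 2F 2F = no λ ()
arc? 2F 3F = yes a23
arc? 3F 0F = no λ ()
arc? 3F 1F = yes a31
arc? 3F 2F = no λ ()
arc? 3F 3F = no λ ()

-- The clause for offset 1 needs no test p = q: vertices in one column lie in
-- one part.
edgeᵇ : (p q : Fin 4) (sameColumn : Bool) (offset : Fin 4) → Bool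
edgeᵇ p q s 0F = false
edgeᵇ p q s 1F = s
edgeᵇ p q s 2F = not s ∧ ⌊ p ≟ q ⌋
edgeᵇ p q s 3F = ⌊ arc? p q ⌋

adjacentᵇ : (p q : Fin 4) (sameColumn : Bool) (x y : Fin 4) → Bool
adjacentᵇ p q s x y = edgeᵇ p q s (y ⊖ x) ∨ edgeᵇ q p s (x ⊖ y)

adjacentᵇ-⊖ : ∀ p q s c x y → adjacentᵇ p q s (x ⊖ c) (y ⊖ c) ≡ adjacentᵇ p q s x y
adjacentᵇ-⊖ p q s c x y rewrite ⊖-⊖-cancel c x y | ⊖-⊖-cancel c y x = refl

-- Shapes of triples of vertices

record Shape : Set where
  constructor shape
  field
    parts   : Vec (Fin 4) 3
    -- positions of the second and third vertex, the first one being at 0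
    offsets : Vec (Fin 4) 2
    -- the k-th entry tells whether the two vertices other than the k-th
    -- share a column
    sameColumns : Vec Bool 3

open Shape

partAt positionAt : Shape → Fin 3 → Fin 4
partAt σ = Vec.lookup (parts σ)
positionAt σ 0F = 0F
positionAt σ (Fin.suc k) = Vec.lookup (offsets σ) k

sameAt : Shape → Fin 3 → Fin 3 → Bool
sameAt σ 0F 0F = true
sameAt σ 1F 1F = true
sameAt σ 2F 2F = true
sameAt σ 1F 2F = Vec.lookup (sameColumns σ) 0F
sameAt σ 2F 1F = Vec.lookup (sameColumns σ) 0F
sameAt σ 0F 2F = Vec.lookup (sameColumns σ) 1F
sameAt σ 2F 0F = Vec.lookup (sameColumns σ) 1F
sameAt σ 0F 1F = Vec.lookup (sameColumns σ) 2F
sameAt σ 1F 0F = Vec.lookup (sameColumns σ) 2F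

adjacentAt : Shape → Fin 3 → Fin 3 → Bool
adjacentAt σ k l = adjacentᵇ (partAt σ k) (partAt σ l) (sameAt σ k l) (positionAt σ k) (positionAt σ l)

chain : Shape → Fin 3 → Fin 3 → Fin 3 → Bool
chain σ k l n = (sameAt σ k l ∧ sameAt σ l n) ⇒ sameAt σ k n

coherent : Shape → Bool
coherent σ =
  allPairs₃ (λ k l → sameAt σ k l ⇒ ⌊ partAt σ k ≟ partAt σ l ⌋)
  ∧ chain σ 0F 1F 2F ∧ chain σ 1F 0F 2F ∧ chain σ 0F 2F 1F

toShape : Vec (Fin 4) 3 × Vec (Fin 4) 2 × Vec Bool 3 → Shape
toShape (p , x , s) = shape p x s

shapes : List Shape
shapes = List.map toShape
  (cartesianProduct (vecs (allFin 4) 3) (cartesianProduct (vecs (allFin 4) 2) (vecs bools 3)))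

shapes-enumerates : IsEnumeration (setoid Shape) shapes
shapes-enumerates (shape p x s) =
  ∈-map⁺ toShape $ ∈-cartesianProduct⁺ (vecs-enumerates ∈-allFin 3 p)
    (∈-cartesianProduct⁺ (vecs-enumerates ∈-allFin 2 x) (vecs-enumerates bools-enumerates 3 s))

-- Each `refl` given to all-elements makes Agda evaluate a check on every
-- shape; this is why the predicates on shapes are Boolean functions.
triangle-free-shapes : ∀ σ → T (coherent σ) →
  T (adjacentAt σ 0F 1F) → T (adjacentAt σ 1F 2F) → T (adjacentAt σ 0F 2F) → ⊥
triangle-free-shapes σ coh a₀₁ a₁₂ a₀₂ =
  not-elim (⇒-elim (all-elements shapes-enumerates noTriangle refl σ) coh)
           (from T-∧ (a₀₁ , from T-∧ (a₁₂ , a₀₂)))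
  where
    noTriangle : Shape → Bool
    noTriangle σ = coherent σ ⇒ not (adjacentAt σ 0F 1F ∧ adjacentAt σ 1F 2F ∧ adjacentAt σ 0F 2F)

-- Where a candidate vertex lies: in the column of the k-th vertex of the
-- triple, or in a column of part q used by none of them.
Site : Set
Site = Fin 3 ⊎ Fin 4

partOfSite : Shape → Site → Fin 4
partOfSite σ (inj₁ k) = partAt σ k
partOfSite σ (inj₂ q) = q

sameAtSite : Shape → Site → Fin 3 → Bool
sameAtSite σ (inj₁ k) l = sameAt σ k l
sameAtSite σ (inj₂ q) l = false

sameColumnIn : Shape → Fin 4 → Fin 3 → Fin 3 → Bool
sameColumnIn σ q k l = (⌊ partAt σ k ≟ q ⌋ ∧ ⌊ partAt σ l ≟ q ⌋) ⇒ sameAt σ k l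

-- A column of part q unused by the triple exists when the vertices of the
-- triple in part q share their column, as every part has two columns.
available : Shape → Site → Bool
available σ (inj₁ k) = true
available σ (inj₂ q) = allPairs₃ (sameColumnIn σ q)

differentFrom : Shape → Site → Fin 4 → Fin 3 → Bool
differentFrom σ s t l = not (sameAtSite σ s l ∧ ⌊ t ≟ positionAt σ l ⌋)

adjacentFrom : Shape → Site → Fin 4 → Fin 3 → Bool
adjacentFrom σ s t l = adjacentᵇ (partOfSite σ s) (partAt σ l) (sameAtSite σ s l) t (positionAt σ l)

-- β marks the vertices of the triple that the candidate must be adjacent to.
separatesFrom : Shape → Vec Bool 3 → Site → Fin 4 → Fin 3 → Bool
separatesFrom σ β s t l = differentFrom σ s t l ∧ ⌊ adjacentFrom σ s t l ≟ᵇ Vec.lookup β l ⌋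

separates : Shape → Vec Bool 3 → Site × Fin 4 → Bool
separates σ β (s , t) = available σ s ∧ all₃ (separatesFrom σ β s t)

consistentLabels : Shape → Vec Bool 3 → Fin 3 → Fin 3 → Bool
consistentLabels σ β k l =
  (sameAt σ k l ∧ ⌊ positionAt σ k ≟ positionAt σ l ⌋) ⇒ ⌊ Vec.lookup β k ≟ᵇ Vec.lookup β l ⌋

independentLabels : Shape → Vec Bool 3 → Fin 3 → Fin 3 → Bool
independentLabels σ β k l = (Vec.lookup β k ∧ Vec.lookup β l) ⇒ not (adjacentAt σ k l)

admissible : Shape → Vec Bool 3 → Bool
admissible σ β =
  coherent σ ∧ allPairs₃ λ k l → consistentLabels σ β k l ∧ independentLabels σ β k l

candidates : List (Site × Fin 4)
candidates = cartesianProduct (List.map inj₁ (allFin 3) ++ List.map inj₂ (allFin 4)) (allFin 4)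

separable-shapes : ∀ σ β → T (admissible σ β) → ∃ (T ∘ separates σ β)
separable-shapes σ β adm =
  any-element candidates (separates σ β)
    (⇒-elim (all-elements configurations-enumerate separable refl (σ , β)) adm)
  where
    configurations-enumerate : IsEnumeration (setoid (Shape × Vec Bool 3))
                                             (cartesianProduct shapes (vecs bools 3))
    configurations-enumerate (σ , β) =
      ∈-cartesianProduct⁺ (shapes-enumerates σ) (vecs-enumerates bools-enumerates 3 β)

    separable : Shape × Vec Bool 3 → Bool
    separable (σ , β) = admissible σ β ⇒ any (separates σ β) candidates

-- The twisted graph

covering : A → (xs : List A) → length xs ≤ n →
           Σ (Vec A n) λ a → ∀ {x} → x ∈ xs → ∃ λ k → x ≡ Vec.lookup a k
covering {n = n} d [] _ = replicate n d , λ ()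
covering d (x ∷ xs) (s≤s |xs|≤n) =
  let a , cover = covering d xs |xs|≤n
  in x ∷ a , λ { (here x≡) → 0F , x≡ ; (there y∈) → let k , y≡ = cover y∈ in Fin.suc k , y≡ }

two-indices : 2 ≤ n → Σ (Fin n × Fin n) λ (j , j′) → j ≢ j′
two-indices (s≤s (s≤s _)) = (0F , 1F) , λ ()

module _ (m : Fin 4 → ℕ) where

  Column : Set
  Column = Σ (Fin 4) λ i → Fin (m i)

  column : TVertex m → Column
  column (i , j , _) = i , j

  part : TVertex m → Fin 4
  part = proj₁

  position : TVertex m → Fin 4
  position (_ , _ , x) = x

  _≟ᶜ_ : DecidableEquality Column
  _≟ᶜ_ = ≡-dec _≟_ _≟_

  _≟ᵛ_ : DecidableEquality (TVertex m)
  _≟ᵛ_ = ≡-dec _≟_ (≡-dec _≟_ _≟_)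

  sameColumn : TVertex m → TVertex m → Bool
  sameColumn u v = ⌊ column u ≟ᶜ column v ⌋

  column-injective : ∀ {i} {j j′ : Fin (m i)} → _≡_ {A = Column} (i , j) (i , j′) → j ≡ j′
  column-injective refl = refl

  column-position-injective : ∀ u v → column u ≡ column v → position u ≡ position v → u ≡ v
  column-position-injective _ _ refl refl = refl

  sameColumn-≢ : ∀ {u v} → column u ≢ column v → sameColumn u v ≡ false
  sameColumn-≢ {u} {v} ne = to (T-not-≡ {sameColumn u v}) (fromWitnessFalse ne)

  sameColumn-refl : ∀ u → sameColumn u u ≡ true
  sameColumn-refl u = to (T-≡ {sameColumn u u}) (fromWitness refl)

  sameColumn-sym : ∀ u v → sameColumn u v ≡ sameColumn v u
  sameColumn-sym u v = ⇔→≡ (mk⇔ (flip u v) (flip v u))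
    where
      flip : ∀ u v → sameColumn u v ≡ true → sameColumn v u ≡ true
      flip u v = to T-≡ ∘ fromWitness ∘ sym ∘ toWitness ∘ from T-≡

  sameColumn-samePart : ∀ u v → T (sameColumn u v ⇒ ⌊ part u ≟ part v ⌋)
  sameColumn-samePart u v = ⇒-intro {sameColumn u v} (fromWitness ∘ cong proj₁ ∘ toWitness)

  sameColumn-trans : ∀ u v w → T ((sameColumn u v ∧ sameColumn v w) ⇒ sameColumn u w)
  sameColumn-trans u v w = ⇒-intro λ h →
    let uv , vw = to (T-∧ {sameColumn u v}) h in fromWitness (trans (toWitness uv) (toWitness vw))

  edge⇒edgeᵇ : ∀ {u v} → TEdge m u v →
               T (edgeᵇ (part u) (part v) (sameColumn u v) (position v ⊖ position u))
  edge⇒edgeᵇ (e1 i j x) rewrite ⊖-+₄ x 1F = fromWitness refl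
  edge⇒edgeᵇ (e2 i j j′ x j≢j′)
    rewrite ⊖-+₄ x 2F | sameColumn-≢ {i , j , x} {i , j′ , x +₄ 2} (j≢j′ ∘ column-injective) =
    fromWitness refl
  edge⇒edgeᵇ (e3 i i′ j j′ x arc) rewrite ⊖-+₄ x 3F = fromWitness arc

  edgeᵇ⇒edge : ∀ i j x i′ j′ d (c? : Dec (_≡_ {A = Column} (i , j) (i′ , j′))) →
               T (edgeᵇ i i′ ⌊ c? ⌋ d) → TEdge m (i , j , x) (i′ , j′ , x +₄ toℕ d)
  edgeᵇ⇒edge i j x _ _ 1F (yes refl) _ = e1 i j x
  edgeᵇ⇒edge i j x i′ j′ 2F (no ≢) h with toWitness h
  ... | refl = e2 i j j′ x (≢ ∘ cong (i ,_))
  edgeᵇ⇒edge i j x i′ j′ 3F _ h = e3 i i′ j j′ x (toWitness h)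

  edge⇔edgeᵇ : ∀ u v →
    TEdge m u v ⇔ T (edgeᵇ (part u) (part v) (sameColumn u v) (position v ⊖ position u))
  edge⇔edgeᵇ (i , j , x) (i′ , j′ , y) = mk⇔ edge⇒edgeᵇ λ h →
    subst (λ y → TEdge m (i , j , x) (i′ , j′ , y)) (+₄-⊖ x y)
          (edgeᵇ⇒edge i j x i′ j′ (y ⊖ x) ((i , j) ≟ᶜ (i′ , j′)) h)

  adjacent⇔adjacentᵇ : ∀ u v →
    TAdj m u v ⇔ T (adjacentᵇ (part u) (part v) (sameColumn u v) (position u) (position v))
  adjacent⇔adjacentᵇ u v =
    mk⇔ (from T-∨ ∘ Sum.map (to (edge⇔edgeᵇ u v)) (to backward))
        (Sum.map (from (edge⇔edgeᵇ u v)) (from backward) ∘ to T-∨)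
    where
      backward : TEdge m v u ⇔ T (edgeᵇ (part v) (part u) (sameColumn u v) (position u ⊖ position v))
      backward rewrite sameColumn-sym u v = edge⇔edgeᵇ v u

  adjacent-by-shape : ∀ {u v p q s x y} c → part u ≡ p → part v ≡ q → sameColumn u v ≡ s →
                      position u ⊖ c ≡ x → position v ⊖ c ≡ y → TAdj m u v ⇔ T (adjacentᵇ p q s x y)
  adjacent-by-shape {u} {v} c refl refl refl refl refl
    rewrite adjacentᵇ-⊖ (part u) (part v) (sameColumn u v) c (position u) (position v) =
    adjacent⇔adjacentᵇ u v

  distinct-by-shape : ∀ {u v s x y} c → sameColumn u v ≡ s →
                      position u ⊖ c ≡ x → position v ⊖ c ≡ y → T (not (s ∧ ⌊ x ≟ y ⌋)) → u ≢ v
  distinct-by-shape {u} c refl refl refl h refl =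
    not-elim h (from (T-∧ {sameColumn u u}) (fromWitness refl , fromWitness refl))

  origin : Vec (TVertex m) 3 → Fin 4
  origin a = position (Vec.head a)

  shapeOf : Vec (TVertex m) 3 → Shape
  shapeOf a@(a₀ ∷ a₁ ∷ a₂ ∷ []) =
    shape (Vec.map part a) (position a₁ ⊖ position a₀ ∷ position a₂ ⊖ position a₀ ∷ [])
          (sameColumn a₁ a₂ ∷ sameColumn a₀ a₂ ∷ sameColumn a₀ a₁ ∷ [])

  partAt-shapeOf : ∀ a k → partAt (shapeOf a) k ≡ part (Vec.lookup a k)
  partAt-shapeOf a@(_ ∷ _ ∷ _ ∷ []) k = lookup-map k part a

  positionAt-shapeOf : ∀ a k → positionAt (shapeOf a) k ≡ position (Vec.lookup a k) ⊖ origin a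
  positionAt-shapeOf (a₀ ∷ _ ∷ _ ∷ []) 0F = sym (⊖-self (position a₀))
  positionAt-shapeOf (_ ∷ _ ∷ _ ∷ []) 1F = refl
  positionAt-shapeOf (_ ∷ _ ∷ _ ∷ []) 2F = refl

  sameAt-shapeOf : ∀ a k l → sameAt (shapeOf a) k l ≡ sameColumn (Vec.lookup a k) (Vec.lookup a l)
  sameAt-shapeOf (a₀ ∷ _ ∷ _ ∷ []) 0F 0F = sym (sameColumn-refl a₀)
  sameAt-shapeOf (_ ∷ a₁ ∷ _ ∷ []) 1F 1F = sym (sameColumn-refl a₁)
  sameAt-shapeOf (_ ∷ _ ∷ a₂ ∷ []) 2F 2F = sym (sameColumn-refl a₂)
  sameAt-shapeOf (_ ∷ _ ∷ _ ∷ []) 0F 1F = refl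
  sameAt-shapeOf (_ ∷ _ ∷ _ ∷ []) 0F 2F = refl
  sameAt-shapeOf (_ ∷ _ ∷ _ ∷ []) 1F 2F = refl
  sameAt-shapeOf (a₀ ∷ a₁ ∷ _ ∷ []) 1F 0F = sameColumn-sym a₀ a₁
  sameAt-shapeOf (a₀ ∷ _ ∷ a₂ ∷ []) 2F 0F = sameColumn-sym a₀ a₂
  sameAt-shapeOf (_ ∷ a₁ ∷ a₂ ∷ []) 2F 1F = sameColumn-sym a₁ a₂

  adjacentAt-shapeOf : ∀ a k l → TAdj m (Vec.lookup a k) (Vec.lookup a l) ⇔ T (adjacentAt (shapeOf a) k l)
  adjacentAt-shapeOf a k l =
    adjacent-by-shape (origin a) (sym (partAt-shapeOf a k)) (sym (partAt-shapeOf a l)) (sym (sameAt-shapeOf a k l))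
                      (sym (positionAt-shapeOf a k)) (sym (positionAt-shapeOf a l))

  coherent-shapeOf : ∀ a → T (coherent (shapeOf a))
  coherent-shapeOf a =
    from T-∧ (allPairs₃-intro partsAgree ,
    from T-∧ (chainHolds 0F 1F 2F , from T-∧ (chainHolds 1F 0F 2F , chainHolds 0F 2F 1F)))
    where
      partsAgree : ∀ k l → T (sameAt (shapeOf a) k l ⇒ ⌊ partAt (shapeOf a) k ≟ partAt (shapeOf a) l ⌋)
      partsAgree k l rewrite sameAt-shapeOf a k l | partAt-shapeOf a k | partAt-shapeOf a l =
        sameColumn-samePart (Vec.lookup a k) (Vec.lookup a l)
      chainHolds : ∀ k l n → T (chain (shapeOf a) k l n)
      chainHolds k l n rewrite sameAt-shapeOf a k l | sameAt-shapeOf a l n | sameAt-shapeOf a k n =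
        sameColumn-trans (Vec.lookup a k) (Vec.lookup a l) (Vec.lookup a n)

  _∈ᵇ_ : TVertex m → List (TVertex m) → Bool
  v ∈ᵇ B = ⌊ DecMembership._∈?_ _≟ᵛ_ v B ⌋

  labels : List (TVertex m) → Vec (TVertex m) 3 → Vec Bool 3
  labels B = Vec.map (_∈ᵇ B)

  label⇔∈ : ∀ B a l → T (Vec.lookup (labels B a) l) ⇔ Vec.lookup a l ∈ B
  label⇔∈ B a l rewrite lookup-map l (_∈ᵇ B) a = mk⇔ toWitness fromWitness

  labels-consistent : ∀ B a k l → T (consistentLabels (shapeOf a) (labels B a) k l)
  labels-consistent B a k l
    rewrite sameAt-shapeOf a k l | positionAt-shapeOf a k | positionAt-shapeOf a l
          | lookup-map k (_∈ᵇ B) a | lookup-map l (_∈ᵇ B) a =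
    ⇒-intro {sameColumn u v ∧ ⌊ position u ⊖ origin a ≟ position v ⊖ origin a ⌋} λ h →
      let same , samePosition = to (T-∧ {sameColumn u v}) h
      in fromWitness (cong (_∈ᵇ B) (column-position-injective u v (toWitness same)
                                      (⊖-injective (origin a) _ _ (toWitness samePosition))))
    where
      u v : TVertex m
      u = Vec.lookup a k
      v = Vec.lookup a l

  labels-independent : ∀ B → Independent (Twisted m) B → ∀ a k l →
                       T (independentLabels (shapeOf a) (labels B a) k l)
  labels-independent B independent a k l =
    ⇒-intro {Vec.lookup (labels B a) k ∧ Vec.lookup (labels B a) l} λ h →
    let inBk , inBl = to (T-∧ {Vec.lookup (labels B a) k}) h
    in not-intro (independent _ _ (to (label⇔∈ B a k) inBk) (to (label⇔∈ B a l) inBl)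
                  ∘ from (adjacentAt-shapeOf a k l))

  admissible-labels : ∀ B → Independent (Twisted m) B → ∀ a → T (admissible (shapeOf a) (labels B a))
  admissible-labels B independent a =
    from (T-∧ {coherent (shapeOf a)}) (coherent-shapeOf a , allPairs₃-intro λ k l →
      from (T-∧ {consistentLabels (shapeOf a) (labels B a) k l})
           (labels-consistent B a k l , labels-independent B independent a k l))

  triangle-free : TriangleFree (Twisted m)
  triangle-free x y z (xy , yz , xz) =
    triangle-free-shapes (shapeOf a) (coherent-shapeOf a)
      (to (adjacentAt-shapeOf a 0F 1F) xy) (to (adjacentAt-shapeOf a 1F 2F) yz)
      (to (adjacentAt-shapeOf a 0F 2F) xz)
    where
      a : Vec (TVertex m) 3
      a = x ∷ y ∷ z ∷ []

  module _ (m≥2 : ∀ i → 2 ≤ m i) where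

    avoidingColumn : ∀ q (c : Column) → ∃ λ j → (q , j) ≢ c
    avoidingColumn q c with two-indices (m≥2 q)
    ... | (j , j′) , j≢j′ with (q , j) ≟ᶜ c
    ...   | no ≢c = j , ≢c
    ...   | yes refl = j′ , j≢j′ ∘ sym ∘ column-injective

    sameColumnIn-columns : ∀ q u v → T ((⌊ part u ≟ q ⌋ ∧ ⌊ part v ≟ q ⌋) ⇒ sameColumn u v) →
                           part u ≡ q → part v ≡ q → column u ≡ column v
    sameColumnIn-columns q u v h pu pv =
      toWitness (⇒-elim {⌊ part u ≟ q ⌋ ∧ ⌊ part v ≟ q ⌋} h
                        (from (T-∧ {⌊ part u ≟ q ⌋}) (fromWitness pu , fromWitness pv)))

    sharedColumn : ∀ a q → T (available (shapeOf a) (inj₂ q)) →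
                   ∃ λ c → ∀ l → part (Vec.lookup a l) ≡ q → column (Vec.lookup a l) ≡ c
    sharedColumn a@(a₀ ∷ a₁ ∷ a₂ ∷ []) q av
      with allPairs₃-elim (sameColumnIn (shapeOf a) q) av | part a₀ ≟ q | part a₁ ≟ q
    ... | s₀₁ , s₀₂ , _ | yes p₀ | _ =
      column a₀ , λ { 0F _ → refl
                    ; 1F p₁ → sym (sameColumnIn-columns q a₀ a₁ s₀₁ p₀ p₁)
                    ; 2F p₂ → sym (sameColumnIn-columns q a₀ a₂ s₀₂ p₀ p₂) }
    ... | _ , _ , s₁₂ | no ¬p₀ | yes p₁ =
      column a₁ , λ { 0F p₀ → ⊥-elim (¬p₀ p₀)
                    ; 1F _ → refl
                    ; 2F p₂ → sym (sameColumnIn-columns q a₁ a₂ s₁₂ p₁ p₂) }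
    ... | _ | no ¬p₀ | no ¬p₁ =
      column a₂ , λ { 0F p₀ → ⊥-elim (¬p₀ p₀) ; 1F p₁ → ⊥-elim (¬p₁ p₁) ; 2F _ → refl }

    freshColumn : ∀ a q → T (available (shapeOf a) (inj₂ q)) →
                  ∃ λ j → ∀ l → (q , j) ≢ column (Vec.lookup a l)
    freshColumn a q av =
      let c , shared = sharedColumn a q av
          j , j≢c = avoidingColumn q c
      in j , λ l eq → j≢c (trans eq (shared l (sym (cong proj₁ eq))))

    record Realisation (a : Vec (TVertex m) 3) (s : Site) (t : Fin 4) : Set where
      field
        vertex      : TVertex m
        part≡       : part vertex ≡ partOfSite (shapeOf a) s
        position≡   : position vertex ⊖ origin a ≡ t
        sameColumn≡ : ∀ l → sameColumn vertex (Vec.lookup a l) ≡ sameAtSite (shapeOf a) s l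

    realise : ∀ a s t → T (available (shapeOf a) s) → Realisation a s t
    realise a (inj₁ k) t _ = record
      { vertex      = let (i , j , _) = Vec.lookup a k in i , j , origin a +₄ toℕ t
      ; part≡       = sym (partAt-shapeOf a k)
      ; position≡   = ⊖-+₄ (origin a) t
      ; sameColumn≡ = λ l → sym (sameAt-shapeOf a k l)
      }
    realise a (inj₂ q) t av = record
      { vertex      = q , j , origin a +₄ toℕ t
      ; part≡       = refl
      ; position≡   = ⊖-+₄ (origin a) t
      ; sameColumn≡ = λ l → sameColumn-≢ {q , j , origin a +₄ toℕ t} {Vec.lookup a l} (fresh l)
      }
      where
        j : Fin (m q)
        j = proj₁ (freshColumn a q av)
        fresh : ∀ l → (q , j) ≢ column (Vec.lookup a l)
        fresh = proj₂ (freshColumn a q av)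

    separating-vertex : ∀ a β → T (admissible (shapeOf a) β) →
      ∃ λ w → ∀ l → w ≢ Vec.lookup a l × (TAdj m w (Vec.lookup a l) ⇔ T (Vec.lookup β l))
    separating-vertex a β adm = vertex , separated
      where
        σ : Shape
        σ = shapeOf a

        found : ∃ (T ∘ separates σ β)
        found = separable-shapes σ β adm

        site : Site
        site = proj₁ (proj₁ found)

        t : Fin 4
        t = proj₂ (proj₁ found)

        available×separates : T (available σ site) × T (all₃ (separatesFrom σ β site t))
        available×separates = to (T-∧ {available σ site}) (proj₂ found)

        open Realisation (realise a site t (proj₁ available×separates))

        separated : ∀ l → vertex ≢ Vec.lookup a l × (TAdj m vertex (Vec.lookup a l) ⇔ T (Vec.lookup β l))
        separated l =
          distinct-by-shape (origin a) (sameColumn≡ l) position≡ (sym (positionAt-shapeOf a l)) different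
          , subst (λ b → TAdj m vertex (Vec.lookup a l) ⇔ T b) (toWitness agrees)
              (adjacent-by-shape (origin a) part≡ (sym (partAt-shapeOf a l)) (sameColumn≡ l) position≡
                                 (sym (positionAt-shapeOf a l)))
          where
            separatesₗ : T (separatesFrom σ β site t l)
            separatesₗ = all₃-elim (separatesFrom σ β site t) (proj₂ available×separates) l

            different : T (differentFrom σ site t l)
            different = proj₁ (to (T-∧ {differentFrom σ site t l}) separatesₗ)

            agrees : T ⌊ adjacentFrom σ site t l ≟ᵇ Vec.lookup β l ⌋
            agrees = proj₂ (to (T-∧ {differentFrom σ site t l}) separatesₗ)

    someVertex : TVertex m
    someVertex = 0F , proj₁ (proj₁ (two-indices (m≥2 0F))) , 0F

    extension : ExtensionProperty3 (Twisted m)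
    extension A B |A|≤3 B⊆A independent = w , w∉A , adjacent-to-B , nonadjacent-to-rest
      where
        cover : Σ (Vec (TVertex m) 3) λ a → ∀ {x} → x ∈ A → ∃ λ k → x ≡ Vec.lookup a k
        cover = covering someVertex A |A|≤3

        a : Vec (TVertex m) 3
        a = proj₁ cover

        separated : ∃ λ w → ∀ l → w ≢ Vec.lookup a l
                                × (TAdj m w (Vec.lookup a l) ⇔ T (Vec.lookup (labels B a) l))
        separated = separating-vertex a (labels B a) (admissible-labels B independent a)

        w : TVertex m
        w = proj₁ separated

        w∉A : w ∉ A
        w∉A w∈A = let k , w≡ = proj₂ cover w∈A in proj₁ (proj₂ separated k) w≡

        adjacent-to-B : ∀ b → b ∈ B → TAdj m w b
        adjacent-to-B b b∈B =
          let k , b≡ = proj₂ cover (B⊆A b b∈B)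
          in subst (TAdj m w) (sym b≡)
               (from (proj₂ (proj₂ separated k)) (from (label⇔∈ B a k) (subst (_∈ B) b≡ b∈B)))

        nonadjacent-to-rest : ∀ x → x ∈ A → x ∉ B → ¬ TAdj m w x
        nonadjacent-to-rest x x∈A x∉B wx =
          let k , x≡ = proj₂ cover x∈A
          in x∉B (subst (_∈ B) (sym x≡)
               (to (label⇔∈ B a k) (to (proj₂ (proj₂ separated k)) (subst (TAdj m w) x≡ wx))))

proposition10 : (m : Fin 4 → ℕ) → (∀ i → 2 ≤ m i) → ThreeECTriangleFree (Twisted m)
proposition10 m m≥2 = triangle-free m , extension m m≥2
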